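{- Let $f$ be a read-once function. Then $\Gamma^0(f)=\mathrm{ds}(f)$ and $\Gamma^1(f)=\mathrm{cs}(f)$.
   Context: A read-once formula is a Boolean formula over AND and OR gates (each gate having at least two inputs) whose leaves are distinct variables, possibly negated; a read-once function $f:\{0,1\}^n\to\{0,1\}$ is one computed by such a formula. $\mathrm{ds}(f)$ is the minimum number of terms in a DNF formula for $f$, and $\mathrm{cs}(f)$ the minimum number of clauses in a CNF formula for $f$. A partial assignment is $b\in\{0,1,*\}^n$; $a\succeq b$ means $a_i=b_i$ whenever $b_i\ne *$. $b$ is a $0$-certificate (resp. $1$-certificate) of $f$ if $f(a)=0$ (resp. $1$) for all $a\in\{0,1\}^n$ with $a\succeq b$. For $b_i=*$, $b_{x_i\leftarrow\ell}$ is $b$ with coordinate $i$ set to $\ell\in\{0,1\}$. $g:\{0,1,*\}^n\to\mathbb{Z}_{\ge0}$ is monotone if $g(b_{x_i\leftarrow\ell})\ge g(b)$ whenever $b_i=*$, and submodular if $g(b_{x_i\leftarrow\ell})-g(b)\ge g(b'_{x_i\leftarrow\ell})-g(b')$ whenever $b'\succeq b$, $b_i=b'_i=*$. A $1$-goal function for $f$ is a monotone submodular $g$ with a constant $Q\ge0$ (its $1$-goal value) such that $g(b)=Q$ if $b$ is a $1$-certificate of $f$ and $g(b)<Q$ otherwise; $\Gamma^1(f)$ is the minimum $1$-goal value of a $1$-goal function for $f$. $0$-goal functions and $\Gamma^0(f)$ are defined analogously with $0$-certificates. -}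

module Defs where

open import Data.Nat using (ℕ; _≤_; _<_; _+_)
open import Data.Bool using (Bool; true; false; _∧_; _∨_; not; if_then_else_)
open import Data.Fin using (Fin; _≟_)
open import Data.Maybe using (Maybe; just; nothing)
open import Data.List using (List; []; _∷_; _++_; length)
open import Data.List.Relation.Unary.Unique.Propositional using (Unique)
open import Data.Product using (Σ; _×_; _,_)
open import Relation.Binary.PropositionalEquality using (_≡_)
open import Relation.Nullary using (¬_; yes; no)

Assignment : ℕ → Set
Assignment n = Fin n → Bool

BoolFun : ℕ → Set
BoolFun n = Assignment n → Bool

data Op : Set where
  AND OR : Op

-- A formula: a literal (variable i, positive if the Bool is true, negated
-- otherwise) or a gate with at least two inputs (two mandatory + a list).
data Formula (n : ℕ) : Set where
  lit  : Fin n → Bool → Formula n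
  gate : Op → Formula n → Formula n → List (Formula n) → Formula n

opApply : Op → Bool → Bool → Bool
opApply AND = _∧_
opApply OR  = _∨_

mutual
  eval : ∀ {n} → Formula n → Assignment n → Bool
  eval (lit i s) a = if s then a i else not (a i)
  eval (gate o φ ψ φs) a = opApply o (eval φ a) (opApply o (eval ψ a) (evalList o φs a))

  evalList : ∀ {n} → Op → List (Formula n) → Assignment n → Bool
  evalList AND [] a = true
  evalList OR  [] a = false
  evalList o (φ ∷ φs) a = opApply o (eval φ a) (evalList o φs a)

mutual
  vars : ∀ {n} → Formula n → List (Fin n)
  vars (lit i s) = i ∷ []
  vars (gate o φ ψ φs) = vars φ ++ vars ψ ++ varsList φs

  varsList : ∀ {n} → List (Formula n) → List (Fin n)
  varsList [] = []
  varsList (φ ∷ φs) = vars φ ++ varsList φs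

IsReadOnceFormula : ∀ {n} → Formula n → Set
IsReadOnceFormula φ = Unique (vars φ)

ReadOnce : ∀ {n} → BoolFun n → Set
ReadOnce {n} f = Σ (Formula n) λ φ → IsReadOnceFormula φ × (∀ a → eval φ a ≡ f a)

Literal : ℕ → Set
Literal n = Fin n × Bool

litVal : ∀ {n} → Literal n → Assignment n → Bool
litVal (i , s) a = if s then a i else not (a i)

termVal : ∀ {n} → List (Literal n) → Assignment n → Bool
termVal [] a = true
termVal (l ∷ ls) a = litVal l a ∧ termVal ls a

dnfVal : ∀ {n} → List (List (Literal n)) → Assignment n → Bool
dnfVal [] a = false
dnfVal (t ∷ ts) a = termVal t a ∨ dnfVal ts a

clauseVal : ∀ {n} → List (Literal n) → Assignment n → Bool
clauseVal [] a = false
clauseVal (l ∷ ls) a = litVal l a ∨ clauseVal ls a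

cnfVal : ∀ {n} → List (List (Literal n)) → Assignment n → Bool
cnfVal [] a = true
cnfVal (c ∷ cs) a = clauseVal c a ∧ cnfVal cs a

HasDNFSize : ∀ {n} → BoolFun n → ℕ → Set
HasDNFSize {n} f m = Σ (List (List (Literal n))) λ d → length d ≡ m × (∀ a → dnfVal d a ≡ f a)

HasCNFSize : ∀ {n} → BoolFun n → ℕ → Set
HasCNFSize {n} f m = Σ (List (List (Literal n))) λ c → length c ≡ m × (∀ a → cnfVal c a ≡ f a)

IsMin : (ℕ → Set) → ℕ → Set
IsMin P m = P m × (∀ k → P k → m ≤ k)

Partial : ℕ → Set
Partial n = Fin n → Maybe Bool   -- nothing = *

_⪰_ : ∀ {n} → Assignment n → Partial n → Set
a ⪰ b = ∀ i c → b i ≡ just c → a i ≡ c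

_⪰ₚ_ : ∀ {n} → Partial n → Partial n → Set
b' ⪰ₚ b = ∀ i c → b i ≡ just c → b' i ≡ just c

set : ∀ {n} → Partial n → Fin n → Bool → Partial n
set b i ℓ j with j ≟ i
... | yes _ = just ℓ
... | no  _ = b j

IsCertificate : ∀ {n} → Bool → BoolFun n → Partial n → Set
IsCertificate ℓ f b = ∀ a → a ⪰ b → f a ≡ ℓ

Monotone : ∀ {n} → (Partial n → ℕ) → Set
Monotone g = ∀ b i ℓ → b i ≡ nothing → g b ≤ g (set b i ℓ)

-- g(b_{i←ℓ}) - g(b) ≥ g(b'_{i←ℓ}) - g(b'), written additively in ℕ
Submodular : ∀ {n} → (Partial n → ℕ) → Set
Submodular g = ∀ b b' i ℓ → b' ⪰ₚ b → b i ≡ nothing → b' i ≡ nothing →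
  g (set b' i ℓ) + g b ≤ g (set b i ℓ) + g b'

IsGoalFunction : ∀ {n} → Bool → BoolFun n → (Partial n → ℕ) → ℕ → Set
IsGoalFunction ℓ f g Q =
  Monotone g × Submodular g ×
  (∀ b → IsCertificate ℓ f b → g b ≡ Q) ×
  (∀ b → ¬ IsCertificate ℓ f b → g b < Q)

HasGoalValue : ∀ {n} → Bool → BoolFun n → ℕ → Set
HasGoalValue {n} ℓ f Q = Σ (Partial n → ℕ) λ g → IsGoalFunction ℓ f g Q

-- View a read-once formula as a binary tree t and let d(t) be its DNF size:
-- 1 at a leaf, the product at an ∧ node, the sum at an ∨ node; distributing gives a DNF of
-- f with d(t) terms. For any DNF, the number of its terms that are dead at b (contain a
-- literal contradicted by b, or two complementary literals) is a 0-goal function whose goal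
-- value is its length, so Γ⁰(f) ≤ ds(f) ≤ d(t). For the converse, take a 0-goal function g
-- with goal value Q and prove, by induction on t and relative to any partial assignment B
-- leaving the variables of t free, that if every non-certificate refining B there lies at
-- least k below Q then g(B) + k·d(t) ≤ Q. At an ∧ node, fixing the variables of one
-- conjunct at a point where it is true turns the gap k of the other into k·d of the first.
-- At an ∨ node the gaps add: filling the variables of each disjunct at a point where it is
-- false, separately (C₁, C₂) and together (a certificate), submodularity gives
-- g(B) + Q ≤ g(C₁) + g(C₂). Taking B empty and k = 1 gives d(t) ≤ Q. The 1-side is the 0-side
-- of ¬f, computed by the dual tree, whose DNFs are the negated CNFs of f.
module Submission where

open import Defs
open import Data.Nat using (ℕ; suc; _+_; _*_; _≤_; _<_; z≤n; s≤s)
open import Data.Nat.Properties hiding (_≟_)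
open import Data.Nat.Solver using (module +-*-Solver)
open +-*-Solver using (solve; _:+_; _:=_)
open import Algebra.Properties.CommutativeSemigroup +-commutativeSemigroup using (interchange)
open import Data.Bool using (Bool; true; false; _∧_; _∨_; not)
open import Data.Bool.Properties
  using (∧-identityʳ; ∨-identityʳ; ∧-zeroʳ; ∨-zeroʳ; ∧-assoc; ∨-assoc; ∨-comm; ∨-conicalˡ;
         ∧-distribˡ-∨; ∧-distribʳ-∨; not-involutive; ¬-not)
open import Data.Fin using (Fin; _≟_)
open import Data.Sum using (_⊎_; inj₁; inj₂)
open import Data.Maybe using (just; nothing; maybe′; fromMaybe)
import Data.Maybe.Properties as Maybe
import Data.Product.Properties as Product
import Data.Bool as Bool
open import Data.List using (List; []; _∷_; _++_; length; map; cartesianProductWith)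
open import Data.List.Properties using (length-map; length-++; ++-identityʳ)
open import Data.List.Membership.Propositional using (_∈_; _∉_; find; lose)
open import Data.List.Membership.Propositional.Properties using (∈-++⁺ˡ; ∈-++⁺ʳ)
open import Data.List.Relation.Binary.Disjoint.Propositional using (Disjoint)
open import Data.List.Relation.Binary.Subset.Propositional using (_⊆_)
open import Data.List.Relation.Unary.Any as Any using (Any; here; there; any?)
open import Data.List.Relation.Unary.All as All using (All; []; _∷_)
open import Data.List.Relation.Unary.All.Properties using (++⁻ˡ; ¬All⇒Any¬)
open import Data.List.Relation.Unary.AllPairs using ([]; _∷_)
open import Data.List.Relation.Unary.Unique.Propositional using (Unique)
open import Data.Product using (Σ; _×_; _,_; proj₁; proj₂; swap)
open import Function using (_∘_; _⇔_; mk⇔; Equivalence)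
open import Relation.Binary.PropositionalEquality
open import Relation.Nullary using (¬_; Dec; does; yes; no; contradiction)
open import Relation.Nullary.Decidable using (decidable-stable; _⊎-dec_)

private
  variable
    n : ℕ

data Tree (n : ℕ) : Set where
  leaf : Literal n → Tree n
  node : Op → Tree n → Tree n → Tree n

⟦_⟧ : Tree n → BoolFun n
⟦ leaf l ⟧ = litVal l
⟦ node o t u ⟧ a = opApply o (⟦ t ⟧ a) (⟦ u ⟧ a)

leaves : Tree n → List (Fin n)
leaves (leaf (i , _)) = i ∷ []
leaves (node _ t u) = leaves t ++ leaves u

dnfSize : Tree n → ℕ
dnfSize (leaf _) = 1
dnfSize (node AND t u) = dnfSize t * dnfSize u
dnfSize (node OR t u) = dnfSize t + dnfSize u

-- A gate with inputs φ, ψ, φ₁, …, φₖ becomes the right comb φ o (ψ o (φ₁ o … φₖ)),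
-- so the unit of o that evalList ends with never appears.
mutual
  toTree : Formula n → Tree n
  toTree (lit i s) = leaf (i , s)
  toTree (gate o φ ψ φs) = node o (toTree φ) (toTree⁺ o ψ φs)

  toTree⁺ : Op → Formula n → List (Formula n) → Tree n
  toTree⁺ o ψ [] = toTree ψ
  toTree⁺ o ψ (φ ∷ φs) = node o (toTree ψ) (toTree⁺ o φ φs)

opApply-evalList-[] : ∀ o x (a : Assignment n) → opApply o x (evalList o [] a) ≡ x
opApply-evalList-[] AND x a = ∧-identityʳ x
opApply-evalList-[] OR x a = ∨-identityʳ x

mutual
  ⟦toTree⟧ : (φ : Formula n) → ⟦ toTree φ ⟧ ≗ eval φ
  ⟦toTree⟧ (lit i s) a = refl
  ⟦toTree⟧ (gate o φ ψ φs) a = cong₂ (opApply o) (⟦toTree⟧ φ a) (⟦toTree⁺⟧ o ψ φs a)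

  ⟦toTree⁺⟧ : ∀ o ψ (φs : List (Formula n)) a →
    ⟦ toTree⁺ o ψ φs ⟧ a ≡ opApply o (eval ψ a) (evalList o φs a)
  ⟦toTree⁺⟧ o ψ [] a = trans (⟦toTree⟧ ψ a) (sym (opApply-evalList-[] o (eval ψ a) a))
  ⟦toTree⁺⟧ AND ψ (φ ∷ φs) a = cong₂ _∧_ (⟦toTree⟧ ψ a) (⟦toTree⁺⟧ AND φ φs a)
  ⟦toTree⁺⟧ OR ψ (φ ∷ φs) a = cong₂ _∨_ (⟦toTree⟧ ψ a) (⟦toTree⁺⟧ OR φ φs a)

mutual
  leaves-toTree : (φ : Formula n) → leaves (toTree φ) ≡ vars φ
  leaves-toTree (lit i s) = refl
  leaves-toTree (gate o φ ψ φs) = cong₂ _++_ (leaves-toTree φ) (leaves-toTree⁺ o ψ φs)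

  leaves-toTree⁺ : ∀ o ψ (φs : List (Formula n)) →
    leaves (toTree⁺ o ψ φs) ≡ vars ψ ++ varsList φs
  leaves-toTree⁺ o ψ [] = trans (leaves-toTree ψ) (sym (++-identityʳ (vars ψ)))
  leaves-toTree⁺ o ψ (φ ∷ φs) = cong₂ _++_ (leaves-toTree ψ) (leaves-toTree⁺ o φ φs)

ReadOnce⇒tree : {f : BoolFun n} → ReadOnce f →
  Σ (Tree n) λ t → Unique (leaves t) × ⟦ t ⟧ ≗ f
ReadOnce⇒tree (φ , u , e) =
  toTree φ , subst Unique (sym (leaves-toTree φ)) u , λ a → trans (⟦toTree⟧ φ a) (e a)

Unique-++⁻ : ∀ {A : Set} (xs : List A) {ys} → Unique (xs ++ ys) →
  Unique xs × Unique ys × Disjoint xs ys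
Unique-++⁻ [] u = [] , u , λ ()
Unique-++⁻ (x ∷ xs) (x∉ ∷ u) with Unique-++⁻ xs u
... | uxs , uys , xs#ys = ++⁻ˡ xs x∉ ∷ uxs , uys , disjoint
  where
  disjoint : Disjoint (x ∷ xs) _
  disjoint (here refl , q) = All.lookup x∉ (∈-++⁺ʳ xs q) refl
  disjoint (there p , q) = xs#ys (p , q)

set-≡ : ∀ (b : Partial n) (i : Fin n) (ℓ : Bool) → set b i ℓ i ≡ just ℓ
set-≡ b i ℓ with i ≟ i
... | yes _ = refl
... | no i≢i = contradiction refl i≢i

set-≢ : ∀ (b : Partial n) {i j} (ℓ : Bool) → j ≢ i → set b i ℓ j ≡ b j
set-≢ b {i} {j} ℓ j≢i with j ≟ i
... | yes j≡i = contradiction j≡i j≢i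
... | no _ = refl

⪰ₚ-refl : {b : Partial n} → b ⪰ₚ b
⪰ₚ-refl i c e = e

⪰ₚ-trans : {b b' b'' : Partial n} → b'' ⪰ₚ b' → b' ⪰ₚ b → b'' ⪰ₚ b
⪰ₚ-trans p q i c e = p i c (q i c e)

set-⪰ₚ : ∀ (b : Partial n) {i} (ℓ : Bool) → b i ≡ nothing → set b i ℓ ⪰ₚ b
set-⪰ₚ b {i} ℓ bi≡* j c bj≡c with j ≟ i
... | yes refl = contradiction (trans (sym bi≡*) bj≡c) λ ()
... | no _ = bj≡c

set-monoʳ : {b b' : Partial n} (i : Fin n) (ℓ : Bool) → b' ⪰ₚ b → set b' i ℓ ⪰ₚ set b i ℓ
set-monoʳ i ℓ b'⪰b j c e with j ≟ i
... | yes _ = e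
... | no _ = b'⪰b j c e

⪰ₚ-free : ∀ {b b' : Partial n} {i} → b' ⪰ₚ b → b' i ≡ nothing → b i ≡ nothing
⪰ₚ-free {b = b} {i = i} b'⪰b b'i≡* with b i in eq
... | nothing = refl
... | just c = contradiction (trans (sym (b'⪰b i c eq)) b'i≡*) λ ()

complete : Partial n → Assignment n → Assignment n
complete b a j = fromMaybe (a j) (b j)

complete-⪰ : ∀ (b : Partial n) (a : Assignment n) → complete b a ⪰ b
complete-⪰ b a j c e rewrite e = refl

Free : List (Fin n) → Partial n → Set
Free W b = ∀ {j} → j ∈ W → b j ≡ nothing

RefinesWithin : List (Fin n) → Partial n → Partial n → Set
RefinesWithin W B b = b ⪰ₚ B × (∀ {j} → j ∉ W → b j ≡ B j)

refines-refl : (W : List (Fin n)) (B : Partial n) → RefinesWithin W B B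
refines-refl W B = ⪰ₚ-refl , λ _ → refl

refines-trans : {W : List (Fin n)} {B C b : Partial n} →
  RefinesWithin W B C → RefinesWithin W C b → RefinesWithin W B b
refines-trans (C⪰B , C-out) (b⪰C , b-out) = ⪰ₚ-trans b⪰C C⪰B , λ j∉W → trans (b-out j∉W) (C-out j∉W)

refines-⊆ : {W W' : List (Fin n)} {B b : Partial n} →
  W ⊆ W' → RefinesWithin W B b → RefinesWithin W' B b
refines-⊆ W⊆W' (b⪰B , b-out) = b⪰B , λ j∉W' → b-out (j∉W' ∘ W⊆W')

-- Filled one `set` at a time, so that monotonicity and submodularity of goal functions
-- apply step by step (a goal function need not respect pointwise equality).

fillAt : Assignment n → Fin n → Partial n → Partial n
fillAt a i b = maybe′ (λ _ → b) (set b i (a i)) (b i)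

fill : Assignment n → List (Fin n) → Partial n → Partial n
fill a [] b = b
fill a (i ∷ W) b = fill a W (fillAt a i b)

fillAt-free : ∀ (a : Assignment n) {i} (b : Partial n) → b i ≡ nothing → fillAt a i b ≡ set b i (a i)
fillAt-free a b bi≡* rewrite bi≡* = refl

fillAt-⪰ₚ : ∀ (a : Assignment n) (i : Fin n) (b : Partial n) → fillAt a i b ⪰ₚ b
fillAt-⪰ₚ a i b with b i in eq
... | nothing = set-⪰ₚ b (a i) eq
... | just _ = ⪰ₚ-refl

fillAt-≢ : ∀ (a : Assignment n) {i j} (b : Partial n) → j ≢ i → fillAt a i b j ≡ b j
fillAt-≢ a {i} b j≢i with b i in eq
... | nothing = set-≢ b (a i) j≢i
... | just _ = refl

fillAt-≡ : ∀ (a : Assignment n) (i : Fin n) (b : Partial n) → (∀ c → b i ≡ just c → a i ≡ c) →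
  fillAt a i b i ≡ just (a i)
fillAt-≡ a i b compatible with b i in eq
... | nothing = set-≡ b i (a i)
... | just c rewrite compatible c refl = eq

fill-⪰ₚ : ∀ (a : Assignment n) (W : List (Fin n)) (b : Partial n) → fill a W b ⪰ₚ b
fill-⪰ₚ a [] b = ⪰ₚ-refl
fill-⪰ₚ a (i ∷ W) b = ⪰ₚ-trans (fill-⪰ₚ a W (fillAt a i b)) (fillAt-⪰ₚ a i b)

fill-∉ : ∀ (a : Assignment n) (W : List (Fin n)) (b : Partial n) {j} → j ∉ W → fill a W b j ≡ b j
fill-∉ a [] b j∉W = refl
fill-∉ a (i ∷ W) b j∉W =
  trans (fill-∉ a W (fillAt a i b) (j∉W ∘ there)) (fillAt-≢ a b (j∉W ∘ here))

fill-∈ : ∀ (a : Assignment n) (W : List (Fin n)) (b : Partial n) {j} → j ∈ W →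
  (∀ c → b j ≡ just c → a j ≡ c) → fill a W b j ≡ just (a j)
fill-∈ a (i ∷ W) b {j} j∈W compatible with j ≟ i
... | yes refl = fill-⪰ₚ a W (fillAt a j b) j (a j) (fillAt-≡ a j b compatible)
... | no j≢i with j∈W
...   | here j≡i = contradiction j≡i j≢i
...   | there j∈W' = fill-∈ a W (fillAt a i b) j∈W'
          λ c e → compatible c (trans (sym (fillAt-≢ a b j≢i)) e)

fill-refines : ∀ (a : Assignment n) (W : List (Fin n)) (b : Partial n) → RefinesWithin W b (fill a W b)
fill-refines a W b = fill-⪰ₚ a W b , fill-∉ a W b

Fixes : List (Fin n) → Assignment n → Partial n → Set
Fixes W a b = ∀ {j} → j ∈ W → b j ≡ just (a j)

fixes-⪰ₚ : {W : List (Fin n)} {a : Assignment n} {b b' : Partial n} →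
  b' ⪰ₚ b → Fixes W a b → Fixes W a b'
fixes-⪰ₚ b'⪰b fixes j∈W = b'⪰b _ _ (fixes j∈W)

fill-fixes-free : ∀ (a : Assignment n) (W : List (Fin n)) (b : Partial n) → Free W b → Fixes W a (fill a W b)
fill-fixes-free a W b free j∈W = fill-∈ a W b j∈W λ c e → contradiction (trans (sym (free j∈W)) e) λ ()

fill-fixes-⪰ : ∀ (a : Assignment n) (W : List (Fin n)) (b : Partial n) → a ⪰ b → Fixes W a (fill a W b)
fill-fixes-⪰ a W b a⪰b j∈W = fill-∈ a W b j∈W (a⪰b _)

DependsOn : BoolFun n → List (Fin n) → Set
DependsOn f W = ∀ a a' → (∀ {j} → j ∈ W → a j ≡ a' j) → f a ≡ f a'

fixes-value : {f : BoolFun n} {W : List (Fin n)} {a a' : Assignment n} {b : Partial n} →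
  DependsOn f W → Fixes W a b → a' ⪰ b → f a' ≡ f a
fixes-value dep fixes a'⪰b = dep _ _ λ j∈W → a'⪰b _ _ (fixes j∈W)

tree-dependsOn : ∀ (t : Tree n) → DependsOn ⟦ t ⟧ (leaves t)
tree-dependsOn (leaf (i , true)) a a' same = same (here refl)
tree-dependsOn (leaf (i , false)) a a' same = cong not (same (here refl))
tree-dependsOn (node o t u) a a' same = cong₂ (opApply o)
  (tree-dependsOn t a a' (same ∘ ∈-++⁺ˡ)) (tree-dependsOn u a a' (same ∘ ∈-++⁺ʳ (leaves t)))

Attains : BoolFun n → Bool → Set
Attains {n} f v = Σ (Assignment n) λ a → f a ≡ v

splice : List (Fin n) → Assignment n → Assignment n → Assignment n
splice W a a' j with any? (j ≟_) W
... | yes _ = a j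
... | no _ = a' j

splice-∈ : ∀ W (a a' : Assignment n) {j} → j ∈ W → splice W a a' j ≡ a j
splice-∈ W a a' {j} j∈W with any? (j ≟_) W
... | yes _ = refl
... | no j∉W = contradiction j∈W j∉W

splice-∉ : ∀ W (a a' : Assignment n) {j} → j ∉ W → splice W a a' j ≡ a' j
splice-∉ W a a' {j} j∉W with any? (j ≟_) W
... | yes j∈W = contradiction j∈W j∉W
... | no _ = refl

attains-both : {f f' : BoolFun n} {W W' : List (Fin n)} {v v' : Bool} →
  Disjoint W W' → DependsOn f W → DependsOn f' W' → Attains f v → Attains f' v' →
  Σ (Assignment n) λ a → f a ≡ v × f' a ≡ v'
attains-both {W = W} W#W' dep dep' (a , fa≡v) (a' , f'a'≡v') =
  splice W a a' ,
  trans (dep _ _ λ j∈W → splice-∈ W a a' j∈W) fa≡v ,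
  trans (dep' _ _ λ j∈W' → splice-∉ W a a' λ j∈W → W#W' (j∈W , j∈W')) f'a'≡v'

attains : (t : Tree n) → Unique (leaves t) → ∀ v → Attains ⟦ t ⟧ v
attains (leaf (i , true)) _ v = (λ _ → v) , refl
attains (leaf (i , false)) _ v = (λ _ → not v) , not-involutive v
attains (node o t u) ro = attainsBy o
  where
  rot = proj₁ (Unique-++⁻ (leaves t) ro)
  rou = proj₁ (proj₂ (Unique-++⁻ (leaves t) ro))
  t#u = proj₂ (proj₂ (Unique-++⁻ (leaves t) ro))

  both : ∀ v → Σ (Assignment _) λ a → ⟦ t ⟧ a ≡ v × ⟦ u ⟧ a ≡ v
  both v = attains-both t#u (tree-dependsOn t) (tree-dependsOn u) (attains t rot v) (attains u rou v)

  attainsBy : ∀ o' v → Attains ⟦ node o' t u ⟧ v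
  attainsBy AND false = let a , e = attains t rot false in a , cong (_∧ ⟦ u ⟧ a) e
  attainsBy OR true = let a , e = attains t rot true in a , cong (_∨ ⟦ u ⟧ a) e
  attainsBy AND true = let a , et , eu = both true in a , cong₂ _∧_ et eu
  attainsBy OR false = let a , et , eu = both false in a , cong₂ _∨_ et eu

certificate-≗ : ∀ {ℓ} {f f' : BoolFun n} {b : Partial n} → f ≗ f' →
  IsCertificate ℓ f b → IsCertificate ℓ f' b
certificate-≗ f≗f' cert a a⪰b = trans (sym (f≗f' a)) (cert a a⪰b)

-- ¬ IsCertificate does not provide a point where f is true; the conclusion, being
-- decidable, may be drawn as if it did.
≤-from-non-certificate : ∀ {f : BoolFun n} {b : Partial n} {m Q : ℕ} →
  ¬ IsCertificate false f b → (∀ a → a ⪰ b → f a ≡ true → m ≤ Q) → m ≤ Q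
≤-from-non-certificate {m = m} {Q} notCert atTrue = decidable-stable (m ≤? Q) λ m≰Q →
  notCert λ a a⪰b → ¬-not λ fa≡true → m≰Q (atTrue a a⪰b fa≡true)

literal-free-not-certificate : ∀ (b : Partial n) i s → b i ≡ nothing →
  ¬ IsCertificate false (litVal (i , s)) b
literal-free-not-certificate b i s bi≡* cert =
  contradiction (trans (sym (cert _ (complete-⪰ b λ _ → s))) (literal-true s)) λ ()
  where
  literal-true : ∀ s → litVal (i , s) (complete b λ _ → s) ≡ true
  literal-true true rewrite bi≡* = refl
  literal-true false rewrite bi≡* = refl

difference-≤-trans : ∀ x y z w u v → x + y ≤ z + w → w + u ≤ y + v → x + u ≤ z + v
difference-≤-trans x y z w u v p q = +-cancelʳ-≤ (y + w) (x + u) (z + v) (begin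
  (x + u) + (y + w) ≡⟨ solve 4 (λ x y w u → (x :+ u) :+ (y :+ w) := (x :+ y) :+ (w :+ u)) refl x y w u ⟩
  (x + y) + (w + u) ≤⟨ +-mono-≤ p q ⟩
  (z + w) + (y + v) ≡⟨ solve 4 (λ z w y v → (z :+ w) :+ (y :+ v) := (z :+ v) :+ (y :+ w)) refl z w y v ⟩
  (z + v) + (y + w) ∎)
  where open ≤-Reasoning

gaps-add : ∀ x y z w Q b → x + y ≤ Q → z + w ≤ Q → Q + b ≤ x + z → b + (y + w) ≤ Q
gaps-add x y z w Q b p q r = +-cancelˡ-≤ Q (b + (y + w)) Q (begin
  Q + (b + (y + w)) ≡⟨ +-assoc Q b (y + w) ⟨
  (Q + b) + (y + w) ≤⟨ +-monoˡ-≤ (y + w) r ⟩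
  (x + z) + (y + w) ≡⟨ interchange x z y w ⟩
  (x + y) + (z + w) ≤⟨ +-mono-≤ p q ⟩
  Q + Q ∎)
  where open ≤-Reasoning

-- Lower bound on goal values

module GoalValueBound {n} {g : Partial n → ℕ} (mono : Monotone g) (sub : Submodular g) where

  fillAt-mono : ∀ a i (b : Partial n) → g b ≤ g (fillAt a i b)
  fillAt-mono a i b with b i in eq
  ... | nothing = mono b i (a i) eq
  ... | just _ = ≤-refl

  fill-mono : ∀ a W (b : Partial n) → g b ≤ g (fill a W b)
  fill-mono a [] b = ≤-refl
  fill-mono a (i ∷ W) b = ≤-trans (fillAt-mono a i b) (fill-mono a W (fillAt a i b))

  fill-submodular : ∀ a W {b b' : Partial n} → Unique W → b' ⪰ₚ b → Free W b' →
    g (fill a W b') + g b ≤ g (fill a W b) + g b'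
  fill-submodular a [] {b} {b'} _ _ _ = ≤-reflexive (+-comm (g b') (g b))
  fill-submodular a (i ∷ W) {b} {b'} (i∉W ∷ uW) b'⪰b free
    rewrite fillAt-free a b (⪰ₚ-free b'⪰b (free (here refl))) | fillAt-free a b' (free (here refl)) =
    difference-≤-trans (g (fill a W b'₁)) (g b₁) (g (fill a W b₁)) (g b'₁) (g b) (g b')
      (fill-submodular a W uW (set-monoʳ i (a i) b'⪰b) free₁)
      (sub b b' i (a i) b'⪰b bi≡* b'i≡*)
    where
    b'i≡* = free (here refl)
    bi≡* = ⪰ₚ-free b'⪰b b'i≡*
    b₁ = set b i (a i)
    b'₁ = set b' i (a i)
    free₁ : Free W b'₁
    free₁ j∈W = trans (set-≢ b' (a i) (≢-sym (All.lookup i∉W j∈W))) (free (there j∈W))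

  CertificateValue : BoolFun n → List (Fin n) → Partial n → ℕ → Set
  CertificateValue f W B Q = ∀ b → RefinesWithin W B b → IsCertificate false f b → g b ≡ Q

  NonCertificateGap : BoolFun n → List (Fin n) → Partial n → ℕ → ℕ → Set
  NonCertificateGap f W B k Q = ∀ b → RefinesWithin W B b → ¬ IsCertificate false f b → g b + k ≤ Q

  -- The induction hypothesis of the lower bound, with d = dnfSize t and W = leaves t.
  GapBound : BoolFun n → List (Fin n) → ℕ → Set
  GapBound f W d = ∀ B k Q → Free W B → CertificateValue f W B Q → NonCertificateGap f W B k Q →
    g B + k * d ≤ Q

  gapBound-leaf : ∀ i s → GapBound ⟦ leaf (i , s) ⟧ (i ∷ []) 1
  gapBound-leaf i s B k Q free _ nonCert = subst (λ z → g B + z ≤ Q) (sym (*-identityʳ k))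
    (nonCert B (refines-refl _ B) (literal-free-not-certificate B i s (free (here refl))))

  -- Fixing the variables of f₂ at a point where f₂ is true leaves the conjunct f₁.
  gapBound-satisfied : ∀ {f₁ f₂ : BoolFun n} {W₁ W₂ d₁} → Disjoint W₁ W₂ → DependsOn f₂ W₂ →
    GapBound f₁ W₁ d₁ → ∀ B k Q → Free (W₁ ++ W₂) B →
    CertificateValue (λ a → f₁ a ∧ f₂ a) (W₁ ++ W₂) B Q →
    NonCertificateGap (λ a → f₁ a ∧ f₂ a) (W₁ ++ W₂) B k Q →
    ∀ {b} a → RefinesWithin W₂ B b → a ⪰ b → f₂ a ≡ true → g (fill a W₂ b) + k * d₁ ≤ Q
  gapBound-satisfied {f₁} {f₂} {W₁} {W₂} W₁#W₂ dep₂ bound₁ B k Q free cert nonCert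
    {b} a r a⪰b f₂a≡true =
    bound₁ C k Q free₁ cert₁ nonCert₁
    where
    C = fill a W₂ b
    C-refines : RefinesWithin W₂ B C
    C-refines = refines-trans r (fill-refines a W₂ b)
    free₁ : Free W₁ C
    free₁ j∈W₁ = trans (proj₂ C-refines λ j∈W₂ → W₁#W₂ (j∈W₁ , j∈W₂)) (free (∈-++⁺ˡ j∈W₁))
    widen : ∀ {b'} → RefinesWithin W₁ C b' → RefinesWithin (W₁ ++ W₂) B b'
    widen r' = refines-trans (refines-⊆ (∈-++⁺ʳ W₁) C-refines) (refines-⊆ ∈-++⁺ˡ r')
    f₂-true : ∀ {b' a'} → b' ⪰ₚ C → a' ⪰ b' → f₂ a' ≡ true
    f₂-true b'⪰C a'⪰b' =
      trans (fixes-value dep₂ (fixes-⪰ₚ b'⪰C (fill-fixes-⪰ a W₂ b a⪰b)) a'⪰b') f₂a≡true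
    cert₁ : CertificateValue f₁ W₁ C Q
    cert₁ b' r' c = cert b' (widen r') λ a' a'⪰b' → cong (_∧ f₂ a') (c a' a'⪰b')
    nonCert₁ : NonCertificateGap f₁ W₁ C k Q
    nonCert₁ b' r' notCert = nonCert b' (widen r') λ c → notCert λ a' a'⪰b' → begin
      f₁ a'         ≡⟨ ∧-identityʳ (f₁ a') ⟨
      f₁ a' ∧ true  ≡⟨ cong (f₁ a' ∧_) (f₂-true (proj₁ r') a'⪰b') ⟨
      f₁ a' ∧ f₂ a' ≡⟨ c a' a'⪰b' ⟩
      false         ∎
      where open ≡-Reasoning

  gapBound-∧ : ∀ {f₁ f₂ : BoolFun n} {W₁ W₂ d₁ d₂} → Disjoint W₁ W₂ → DependsOn f₂ W₂ →
    GapBound f₁ W₁ d₁ → GapBound f₂ W₂ d₂ → GapBound (λ a → f₁ a ∧ f₂ a) (W₁ ++ W₂) (d₁ * d₂)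
  gapBound-∧ {f₁} {f₂} {W₁} {W₂} {d₁} {d₂} W₁#W₂ dep₂ bound₁ bound₂ B k Q free cert nonCert =
    subst (λ z → g B + z ≤ Q) (*-assoc k d₁ d₂)
      (bound₂ B (k * d₁) Q (free ∘ ∈-++⁺ʳ W₁) cert₂ nonCert₂)
    where
    cert₂ : CertificateValue f₂ W₂ B Q
    cert₂ b r c = cert b (refines-⊆ (∈-++⁺ʳ W₁) r) λ a a⪰b →
      trans (cong (f₁ a ∧_) (c a a⪰b)) (∧-zeroʳ (f₁ a))
    nonCert₂ : NonCertificateGap f₂ W₂ B (k * d₁) Q
    nonCert₂ b r notCert = ≤-from-non-certificate notCert λ a a⪰b f₂a≡true →
      ≤-trans (+-monoˡ-≤ (k * d₁) (fill-mono a W₂ b))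
        (gapBound-satisfied W₁#W₂ dep₂ bound₁ B k Q free cert nonCert a r a⪰b f₂a≡true)

  -- Fixing the variables of fⱼ at a point where fⱼ is false leaves the disjunct fᵢ.
  gapBound-falsified : ∀ {f fᵢ fⱼ : BoolFun n} {W Wᵢ Wⱼ dᵢ aⱼ} → (∀ a → f a ≡ fᵢ a ∨ fⱼ a) →
    Wᵢ ⊆ W → Wⱼ ⊆ W → Disjoint Wᵢ Wⱼ → DependsOn fⱼ Wⱼ → fⱼ aⱼ ≡ false → GapBound fᵢ Wᵢ dᵢ →
    ∀ B k Q → Free W B → CertificateValue f W B Q → NonCertificateGap f W B k Q →
    g (fill aⱼ Wⱼ B) + k * dᵢ ≤ Q
  gapBound-falsified {f} {fᵢ} {fⱼ} {W} {Wᵢ} {Wⱼ} {aⱼ = aⱼ}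
    f≡ Wᵢ⊆W Wⱼ⊆W Wᵢ#Wⱼ depⱼ fⱼaⱼ≡false boundᵢ B k Q free cert nonCert =
    boundᵢ C k Q freeᵢ certᵢ nonCertᵢ
    where
    C = fill aⱼ Wⱼ B
    freeᵢ : Free Wᵢ C
    freeᵢ j∈Wᵢ = trans (fill-∉ aⱼ Wⱼ B λ j∈Wⱼ → Wᵢ#Wⱼ (j∈Wᵢ , j∈Wⱼ)) (free (Wᵢ⊆W j∈Wᵢ))
    widen : ∀ {b} → RefinesWithin Wᵢ C b → RefinesWithin W B b
    widen r = refines-trans (refines-⊆ Wⱼ⊆W (fill-refines aⱼ Wⱼ B)) (refines-⊆ Wᵢ⊆W r)
    fⱼ-false : ∀ {b a} → b ⪰ₚ C → a ⪰ b → fⱼ a ≡ false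
    fⱼ-false b⪰C a⪰b =
      trans (fixes-value depⱼ (fixes-⪰ₚ b⪰C (fill-fixes-free aⱼ Wⱼ B (free ∘ Wⱼ⊆W))) a⪰b) fⱼaⱼ≡false
    certᵢ : CertificateValue fᵢ Wᵢ C Q
    certᵢ b r c = cert b (widen r) λ a a⪰b →
      trans (f≡ a) (cong₂ _∨_ (c a a⪰b) (fⱼ-false (proj₁ r) a⪰b))
    nonCertᵢ : NonCertificateGap fᵢ Wᵢ C k Q
    nonCertᵢ b r notCert = nonCert b (widen r) λ c → notCert λ a a⪰b →
      ∨-conicalˡ (fᵢ a) (fⱼ a) (trans (sym (f≡ a)) (c a a⪰b))

  -- Submodularity across the two disjoint blocks: filling W₁ and W₂ together gives a
  -- certificate, whose value Q bounds the sum of the two gaps.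
  gapBound-∨ : ∀ {f₁ f₂ : BoolFun n} {W₁ W₂ d₁ d₂} → Disjoint W₁ W₂ → Unique W₂ →
    DependsOn f₁ W₁ → DependsOn f₂ W₂ → Attains f₁ false → Attains f₂ false →
    GapBound f₁ W₁ d₁ → GapBound f₂ W₂ d₂ → GapBound (λ a → f₁ a ∨ f₂ a) (W₁ ++ W₂) (d₁ + d₂)
  gapBound-∨ {f₁} {f₂} {W₁} {W₂} {d₁} {d₂} W₁#W₂ unique₂ dep₁ dep₂ (a₁ , f₁a₁≡false) (a₂ , f₂a₂≡false)
    bound₁ bound₂ B k Q free cert nonCert =
    subst (λ z → g B + z ≤ Q) (sym (*-distribˡ-+ k d₁ d₂))
      (gaps-add (g C₂) (k * d₁) (g C₁) (k * d₂) Q (g B) bound-C₂ bound-C₁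
        (subst (λ z → z + g B ≤ g C₂ + g C₁) g-C₁₂≡Q submodular))
    where
    C₁ = fill a₁ W₁ B
    C₂ = fill a₂ W₂ B
    C₁₂ = fill a₂ W₂ C₁
    bound-C₂ : g C₂ + k * d₁ ≤ Q
    bound-C₂ = gapBound-falsified (λ _ → refl) ∈-++⁺ˡ (∈-++⁺ʳ W₁) W₁#W₂ dep₂ f₂a₂≡false
      bound₁ B k Q free cert nonCert
    bound-C₁ : g C₁ + k * d₂ ≤ Q
    bound-C₁ = gapBound-falsified (λ a → ∨-comm (f₁ a) (f₂ a)) (∈-++⁺ʳ W₁) ∈-++⁺ˡ (W₁#W₂ ∘ swap)
      dep₁ f₁a₁≡false bound₂ B k Q free cert nonCert
    C₁-free : Free W₂ C₁
    C₁-free j∈W₂ = trans (fill-∉ a₁ W₁ B λ j∈W₁ → W₁#W₂ (j∈W₁ , j∈W₂)) (free (∈-++⁺ʳ W₁ j∈W₂))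
    submodular : g C₁₂ + g B ≤ g C₂ + g C₁
    submodular = fill-submodular a₂ W₂ unique₂ (fill-⪰ₚ a₁ W₁ B) C₁-free
    C₁₂-certificate : IsCertificate false (λ a → f₁ a ∨ f₂ a) C₁₂
    C₁₂-certificate a a⪰C₁₂ = cong₂ _∨_
      (trans (fixes-value dep₁ C₁₂-fixes-W₁ a⪰C₁₂) f₁a₁≡false)
      (trans (fixes-value dep₂ (fill-fixes-free a₂ W₂ C₁ C₁-free) a⪰C₁₂) f₂a₂≡false)
      where
      C₁₂-fixes-W₁ = fixes-⪰ₚ (fill-⪰ₚ a₂ W₂ C₁) (fill-fixes-free a₁ W₁ B (free ∘ ∈-++⁺ˡ))
    g-C₁₂≡Q : g C₁₂ ≡ Q
    g-C₁₂≡Q = cert C₁₂ (refines-trans (refines-⊆ ∈-++⁺ˡ (fill-refines a₁ W₁ B))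
                                      (refines-⊆ (∈-++⁺ʳ W₁) (fill-refines a₂ W₂ C₁)))
                   C₁₂-certificate

  gapBound : (t : Tree n) → Unique (leaves t) → GapBound ⟦ t ⟧ (leaves t) (dnfSize t)
  gapBound (leaf (i , s)) _ = gapBound-leaf i s
  gapBound (node AND t u) ro =
    let rot , rou , t#u = Unique-++⁻ (leaves t) ro in
    gapBound-∧ t#u (tree-dependsOn u) (gapBound t rot) (gapBound u rou)
  gapBound (node OR t u) ro =
    let rot , rou , t#u = Unique-++⁻ (leaves t) ro in
    gapBound-∨ t#u rou (tree-dependsOn t) (tree-dependsOn u) (attains t rot false) (attains u rou false)
      (gapBound t rot) (gapBound u rou)

dnfSize≤goalValue : ∀ (t : Tree n) {f} → Unique (leaves t) → ⟦ t ⟧ ≗ f →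
  ∀ Q → HasGoalValue false f Q → dnfSize t ≤ Q
dnfSize≤goalValue t ro t≗f Q (g , mono , sub , certValue , nonCertValue) =
  ≤-trans (m≤n+m (dnfSize t) (g ⊥ₚ))
    (subst (λ z → g ⊥ₚ + z ≤ Q) (*-identityˡ (dnfSize t))
      (gapBound t ro ⊥ₚ 1 Q (λ _ → refl)
        (λ b _ c → certValue b (certificate-≗ t≗f c))
        (λ b _ notCert → subst (_≤ Q) (+-comm 1 (g b))
          (nonCertValue b (notCert ∘ certificate-≗ (sym ∘ t≗f))))))
  where
  open GoalValueBound mono sub
  ⊥ₚ : Partial _
  ⊥ₚ _ = nothing

-- DNFs

DNF : ℕ → Set
DNF n = List (List (Literal n))

termVal-++ : ∀ (t t' : List (Literal n)) a → termVal (t ++ t') a ≡ termVal t a ∧ termVal t' a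
termVal-++ [] t' a = refl
termVal-++ (l ∷ t) t' a =
  trans (cong (litVal l a ∧_) (termVal-++ t t' a)) (sym (∧-assoc (litVal l a) (termVal t a) (termVal t' a)))

dnfVal-++ : ∀ (D D' : DNF n) a → dnfVal (D ++ D') a ≡ dnfVal D a ∨ dnfVal D' a
dnfVal-++ [] D' a = refl
dnfVal-++ (t ∷ D) D' a =
  trans (cong (termVal t a ∨_) (dnfVal-++ D D' a)) (sym (∨-assoc (termVal t a) (dnfVal D a) (dnfVal D' a)))

dnfVal-map-++ : ∀ t (D : DNF n) a → dnfVal (map (t ++_) D) a ≡ termVal t a ∧ dnfVal D a
dnfVal-map-++ t [] a = sym (∧-zeroʳ (termVal t a))
dnfVal-map-++ t (t' ∷ D) a =
  trans (cong₂ _∨_ (termVal-++ t t' a) (dnfVal-map-++ t D a))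
        (sym (∧-distribˡ-∨ (termVal t a) (termVal t' a) (dnfVal D a)))

dnfVal-product : ∀ (D D' : DNF n) a →
  dnfVal (cartesianProductWith _++_ D D') a ≡ dnfVal D a ∧ dnfVal D' a
dnfVal-product [] D' a = refl
dnfVal-product (t ∷ D) D' a = begin
  dnfVal (map (t ++_) D' ++ cartesianProductWith _++_ D D') a
    ≡⟨ dnfVal-++ (map (t ++_) D') (cartesianProductWith _++_ D D') a ⟩
  dnfVal (map (t ++_) D') a ∨ dnfVal (cartesianProductWith _++_ D D') a
    ≡⟨ cong₂ _∨_ (dnfVal-map-++ t D' a) (dnfVal-product D D' a) ⟩
  (termVal t a ∧ dnfVal D' a) ∨ (dnfVal D a ∧ dnfVal D' a)
    ≡⟨ ∧-distribʳ-∨ (dnfVal D' a) (termVal t a) (dnfVal D a) ⟨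
  (termVal t a ∨ dnfVal D a) ∧ dnfVal D' a ∎
  where open ≡-Reasoning

length-cartesianProductWith : ∀ {A B C : Set} (f : A → B → C) xs ys →
  length (cartesianProductWith f xs ys) ≡ length xs * length ys
length-cartesianProductWith f [] ys = refl
length-cartesianProductWith f (x ∷ xs) ys =
  trans (length-++ (map (f x) ys))
        (cong₂ _+_ (length-map (f x) ys) (length-cartesianProductWith f xs ys))

DNF-∧ : ∀ {f₁ f₂ : BoolFun n} {d₁ d₂} → HasDNFSize f₁ d₁ → HasDNFSize f₂ d₂ →
  HasDNFSize (λ a → f₁ a ∧ f₂ a) (d₁ * d₂)
DNF-∧ (D₁ , refl , D₁≗f₁) (D₂ , refl , D₂≗f₂) =
  cartesianProductWith _++_ D₁ D₂ , length-cartesianProductWith _++_ D₁ D₂ ,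
  λ a → trans (dnfVal-product D₁ D₂ a) (cong₂ _∧_ (D₁≗f₁ a) (D₂≗f₂ a))

DNF-∨ : ∀ {f₁ f₂ : BoolFun n} {d₁ d₂} → HasDNFSize f₁ d₁ → HasDNFSize f₂ d₂ →
  HasDNFSize (λ a → f₁ a ∨ f₂ a) (d₁ + d₂)
DNF-∨ (D₁ , refl , D₁≗f₁) (D₂ , refl , D₂≗f₂) =
  D₁ ++ D₂ , length-++ D₁ , λ a → trans (dnfVal-++ D₁ D₂ a) (cong₂ _∨_ (D₁≗f₁ a) (D₂≗f₂ a))

tree-DNF : (t : Tree n) → HasDNFSize ⟦ t ⟧ (dnfSize t)
tree-DNF (leaf l) = (l ∷ []) ∷ [] , refl , λ a → trans (∨-identityʳ _) (∧-identityʳ _)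
tree-DNF (node AND t u) = DNF-∧ (tree-DNF t) (tree-DNF u)
tree-DNF (node OR t u) = DNF-∨ (tree-DNF t) (tree-DNF u)

-- The 0-goal function of a DNF: the number of its terms that are dead at b

_≟ₗ_ : (l l' : Literal n) → Dec (l ≡ l')
_≟ₗ_ = Product.≡-dec _≟_ Bool._≟_

negLit : Literal n → Literal n
negLit (j , s) = j , not s

litVal-negLit : ∀ (l : Literal n) a → litVal (negLit l) a ≡ not (litVal l a)
litVal-negLit (j , true) a = refl
litVal-negLit (j , false) a = sym (not-involutive (a j))

-- literal (j , s) of term t cannot hold together with b and t
Blocked : Partial n → List (Literal n) → Literal n → Set
Blocked b t (j , s) = b j ≡ just (not s) ⊎ (j , not s) ∈ t

Dead : Partial n → List (Literal n) → Set
Dead b t = Any (Blocked b t) t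

dead? : ∀ (b : Partial n) t → Dec (Dead b t)
dead? b t = any? (λ (j , s) → Maybe.≡-dec Bool._≟_ (b j) (just (not s)) ⊎-dec any? ((j , not s) ≟ₗ_) t) t

dead-mono : ∀ {b b' : Partial n} {t} → b' ⪰ₚ b → Dead b t → Dead b' t
dead-mono b'⪰b = Any.map λ where
  (inj₁ bj≡¬s) → inj₁ (b'⪰b _ _ bj≡¬s)
  (inj₂ j¬s∈t) → inj₂ j¬s∈t

dead-set : ∀ {b b' : Partial n} {i ℓ t} → b' ⪰ₚ b →
  Dead (set b' i ℓ) t → ¬ Dead b' t → Dead (set b i ℓ) t
dead-set {b = b} {b'} {i} {ℓ} b'⪰b dead notDead with find dead
... | (j , s) , l∈t , inj₂ j¬s∈t = contradiction (lose l∈t (inj₂ j¬s∈t)) notDead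
... | (j , s) , l∈t , inj₁ e with j ≟ i
...   | yes refl = lose l∈t (inj₁ (trans (set-≡ b j ℓ) e))
...   | no _ = contradiction (lose l∈t (inj₁ e)) notDead

termVal-true : ∀ (t : List (Literal n)) {a} → (∀ {l} → l ∈ t → litVal l a ≡ true) → termVal t a ≡ true
termVal-true [] _ = refl
termVal-true (l ∷ t) holds = cong₂ _∧_ (holds (here refl)) (termVal-true t (holds ∘ there))

termVal-true⁻ : ∀ (t : List (Literal n)) {a l} → termVal t a ≡ true → l ∈ t → litVal l a ≡ true
termVal-true⁻ (l ∷ t) {a} t≡true (here refl) with litVal l a
... | true = refl
termVal-true⁻ (l ∷ t) {a} t≡true (there l∈t) with litVal l a
... | true = termVal-true⁻ t t≡true l∈t

litVal-opposite : ∀ j s (a : Assignment n) → a j ≡ not s → litVal (j , s) a ≡ false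
litVal-opposite j true a aj≡false = aj≡false
litVal-opposite j false a aj≡true = cong not aj≡true

dead-false : ∀ {b : Partial n} {t a} → Dead b t → a ⪰ b → termVal t a ≡ false
dead-false {b = b} {t} {a} dead a⪰b = ¬-not λ t≡true → blocked-false t≡true (find dead)
  where
  blocked-false : termVal t a ≡ true → ¬ (Σ (Literal _) λ l → l ∈ t × Blocked b t l)
  blocked-false t≡true ((j , s) , l∈t , inj₁ bj≡¬s) = contradiction
    (trans (sym (termVal-true⁻ t t≡true l∈t)) (litVal-opposite j s a (a⪰b j (not s) bj≡¬s))) λ ()
  blocked-false t≡true ((j , s) , l∈t , inj₂ j¬s∈t) = contradiction
    (trans (sym (termVal-true⁻ t t≡true j¬s∈t))
           (trans (litVal-negLit (j , s) a) (cong not (termVal-true⁻ t t≡true l∈t))))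
    λ ()

satisfier : Partial n → List (Literal n) → Assignment n
satisfier b t = complete b λ j → does (any? ((j , true) ≟ₗ_) t)

satisfier-true : ∀ (b : Partial n) t → ¬ Dead b t → termVal t (satisfier b t) ≡ true
satisfier-true b t notDead = termVal-true t λ {l} l∈t → literal-true l l∈t (notBlocked l∈t)
  where
  notBlocked : ∀ {l} → l ∈ t → ¬ Blocked b t l
  notBlocked l∈t blocked = notDead (lose l∈t blocked)
  literal-true : ∀ l → l ∈ t → ¬ Blocked b t l → litVal l (satisfier b t) ≡ true
  literal-true (j , s) l∈t notBlocked with b j
  ... | just c = agreeing s c λ c≡¬s → notBlocked (inj₁ (cong just c≡¬s))
    where
    agreeing : ∀ s c → c ≢ not s → litVal (j , s) (λ _ → c) ≡ true
    agreeing true true _ = refl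
    agreeing false false _ = refl
    agreeing true false c≢¬s = contradiction refl c≢¬s
    agreeing false true c≢¬s = contradiction refl c≢¬s
  ... | nothing with s | any? ((j , true) ≟ₗ_) t
  ...   | true | yes _ = refl
  ...   | true | no j∉t = contradiction l∈t j∉t
  ...   | false | yes j∈t = contradiction (inj₂ j∈t) notBlocked
  ...   | false | no _ = refl

dnfVal-false : ∀ (D : DNF n) {a} → (∀ {t} → t ∈ D → termVal t a ≡ false) → dnfVal D a ≡ false
dnfVal-false [] _ = refl
dnfVal-false (t ∷ D) allFalse = cong₂ _∨_ (allFalse (here refl)) (dnfVal-false D (allFalse ∘ there))

dnfVal-true : ∀ (D : DNF n) {a t} → t ∈ D → termVal t a ≡ true → dnfVal D a ≡ true
dnfVal-true (t ∷ D) (here refl) t≡true = cong (_∨ dnfVal D _) t≡true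
dnfVal-true (t' ∷ D) (there t∈D) t≡true =
  trans (cong (termVal t' _ ∨_) (dnfVal-true D t∈D t≡true)) (∨-zeroʳ _)

certificate⇔all-dead : ∀ (D : DNF n) b → IsCertificate false (dnfVal D) b ⇔ All (Dead b) D
certificate⇔all-dead D b = mk⇔
  (λ cert → All.tabulate λ {t} t∈D → decidable-stable (dead? b t) λ notDead →
    contradiction (trans (sym (dnfVal-true D t∈D (satisfier-true b t notDead)))
                         (cert _ (complete-⪰ b _))) λ ())
  (λ allDead a a⪰b → dnfVal-false D λ t∈D → dead-false (All.lookup allDead t∈D) a⪰b)

indicator : {A : Set} → Dec A → ℕ
indicator (yes _) = 1
indicator (no _) = 0

indicator-mono : {A B : Set} (x : Dec A) (y : Dec B) → (A → B) → indicator x ≤ indicator y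
indicator-mono (yes a) (yes _) _ = ≤-refl
indicator-mono (yes a) (no ¬b) A→B = contradiction (A→B a) ¬b
indicator-mono (no _) y _ = z≤n

indicator-≤-1 : {A : Set} (x : Dec A) → indicator x ≤ 1
indicator-≤-1 (yes _) = ≤-refl
indicator-≤-1 (no _) = z≤n

-- x, y, u, v stand for a term being dead at b, b', b[i←ℓ], b'[i←ℓ]
indicator-submodular : {X Y U V : Set} (x : Dec X) (y : Dec Y) (u : Dec U) (v : Dec V) →
  (X → Y) → (X → U) → (Y → V) → (V → ¬ Y → U) → indicator v + indicator x ≤ indicator u + indicator y
indicator-submodular (yes _) (yes _) (yes _) (yes _) _ _ _ _ = ≤-refl
indicator-submodular (yes px) (no ¬py) _ _ X→Y _ _ _ = contradiction (X→Y px) ¬py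
indicator-submodular (yes px) (yes _) (no ¬pu) _ _ X→U _ _ = contradiction (X→U px) ¬pu
indicator-submodular (yes _) (yes py) (yes _) (no ¬pv) _ _ Y→V _ = contradiction (Y→V py) ¬pv
indicator-submodular (no _) _ u (no _) _ _ _ _ = z≤n
indicator-submodular (no _) (yes _) u (yes _) _ _ _ _ = m≤n+m 1 (indicator u)
indicator-submodular (no _) (no _) (yes _) (yes _) _ _ _ _ = ≤-refl
indicator-submodular (no _) (no ¬py) (no ¬pu) (yes pv) _ _ _ V→¬Y→U = contradiction (V→¬Y→U pv ¬py) ¬pu

deadTerms : Partial n → DNF n → ℕ
deadTerms b [] = 0
deadTerms b (t ∷ D) = indicator (dead? b t) + deadTerms b D

deadTerms-≤-length : ∀ (b : Partial n) D → deadTerms b D ≤ length D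
deadTerms-≤-length b [] = z≤n
deadTerms-≤-length b (t ∷ D) = +-mono-≤ (indicator-≤-1 (dead? b t)) (deadTerms-≤-length b D)

deadTerms-all : ∀ {b : Partial n} {D} → All (Dead b) D → deadTerms b D ≡ length D
deadTerms-all {b = b} {t ∷ D} (dead ∷ allDead) with dead? b t
... | yes _ = cong suc (deadTerms-all allDead)
... | no notDead = contradiction dead notDead
deadTerms-all {D = []} [] = refl

deadTerms-some-live : ∀ {b : Partial n} {D} → Any (¬_ ∘ Dead b) D → deadTerms b D < length D
deadTerms-some-live {b = b} {t ∷ D} (here notDead) with dead? b t
... | yes dead = contradiction dead notDead
... | no _ = s≤s (deadTerms-≤-length b D)
deadTerms-some-live {b = b} {t ∷ D} (there someLive) =
  subst (_≤ length (t ∷ D)) (+-suc (indicator (dead? b t)) (deadTerms b D))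
    (+-mono-≤ (indicator-≤-1 (dead? b t)) (deadTerms-some-live someLive))

deadTerms-mono : ∀ {b b' : Partial n} D → b' ⪰ₚ b → deadTerms b D ≤ deadTerms b' D
deadTerms-mono {b = b} {b'} [] _ = z≤n
deadTerms-mono {b = b} {b'} (t ∷ D) b'⪰b =
  +-mono-≤ (indicator-mono (dead? b t) (dead? b' t) (dead-mono b'⪰b)) (deadTerms-mono D b'⪰b)

deadTerms-submodular : ∀ {b b' : Partial n} {i ℓ} D → b' ⪰ₚ b → b i ≡ nothing → b' i ≡ nothing →
  deadTerms (set b' i ℓ) D + deadTerms b D ≤ deadTerms (set b i ℓ) D + deadTerms b' D
deadTerms-submodular [] _ _ _ = z≤n
deadTerms-submodular {b = b} {b'} {i} {ℓ} (t ∷ D) b'⪰b bi≡* b'i≡* = begin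
  (v + V) + (x + X) ≡⟨ interchange v V x X ⟩
  (v + x) + (V + X) ≤⟨ +-mono-≤ term (deadTerms-submodular D b'⪰b bi≡* b'i≡*) ⟩
  (u + y) + (U + Y) ≡⟨ interchange u y U Y ⟩
  (u + U) + (y + Y) ∎
  where
  open ≤-Reasoning
  x = indicator (dead? b t)
  y = indicator (dead? b' t)
  u = indicator (dead? (set b i ℓ) t)
  v = indicator (dead? (set b' i ℓ) t)
  X = deadTerms b D
  Y = deadTerms b' D
  U = deadTerms (set b i ℓ) D
  V = deadTerms (set b' i ℓ) D
  term : v + x ≤ u + y
  term = indicator-submodular (dead? b t) (dead? b' t) (dead? (set b i ℓ) t) (dead? (set b' i ℓ) t)
    (dead-mono b'⪰b) (dead-mono (set-⪰ₚ b ℓ bi≡*)) (dead-mono (set-⪰ₚ b' ℓ b'i≡*)) (dead-set b'⪰b)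

DNF⇒goalValue : ∀ {f : BoolFun n} {m} → HasDNFSize f m → HasGoalValue false f m
DNF⇒goalValue {f = f} (D , refl , D≗f) =
  (λ b → deadTerms b D) ,
  (λ b i ℓ bi≡* → deadTerms-mono D (set-⪰ₚ b ℓ bi≡*)) ,
  (λ b b' i ℓ b'⪰b bi≡* b'i≡* → deadTerms-submodular D b'⪰b bi≡* b'i≡*) ,
  (λ b cert → deadTerms-all (Equivalence.to (certificate⇔all-dead D b) (certificate-≗ (sym ∘ D≗f) cert))) ,
  λ b notCert → deadTerms-some-live (¬All⇒Any¬ (dead? b) D λ allDead →
    notCert (certificate-≗ D≗f (Equivalence.from (certificate⇔all-dead D b) allDead)))

DNF-≗ : ∀ {f f' : BoolFun n} {m} → f ≗ f' → HasDNFSize f m → HasDNFSize f' m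
DNF-≗ f≗f' (D , length≡m , D≗f) = D , length≡m , λ a → trans (D≗f a) (f≗f' a)

dnfSize-minimal : ∀ (t : Tree n) {f} → Unique (leaves t) → ⟦ t ⟧ ≗ f →
  IsMin (HasGoalValue false f) (dnfSize t) × IsMin (HasDNFSize f) (dnfSize t)
dnfSize-minimal t ro t≗f =
  (DNF⇒goalValue dnf , dnfSize≤goalValue t ro t≗f) ,
  (dnf , λ k hasDNF → dnfSize≤goalValue t ro t≗f k (DNF⇒goalValue hasDNF))
  where
  dnf = DNF-≗ t≗f (tree-DNF t)

-- Duality

not-∧ : ∀ x y → not (x ∧ y) ≡ not x ∨ not y
not-∧ true y = refl
not-∧ false y = refl

not-∨ : ∀ x y → not (x ∨ y) ≡ not x ∧ not y
not-∨ true y = refl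
not-∨ false y = refl

dual : Tree n → Tree n
dual (leaf l) = leaf (negLit l)
dual (node AND t u) = node OR (dual t) (dual u)
dual (node OR t u) = node AND (dual t) (dual u)

⟦dual⟧ : ∀ (t : Tree n) a → ⟦ dual t ⟧ a ≡ not (⟦ t ⟧ a)
⟦dual⟧ (leaf l) a = litVal-negLit l a
⟦dual⟧ (node AND t u) a = trans (cong₂ _∨_ (⟦dual⟧ t a) (⟦dual⟧ u a)) (sym (not-∧ (⟦ t ⟧ a) (⟦ u ⟧ a)))
⟦dual⟧ (node OR t u) a = trans (cong₂ _∧_ (⟦dual⟧ t a) (⟦dual⟧ u a)) (sym (not-∨ (⟦ t ⟧ a) (⟦ u ⟧ a)))

leaves-dual : (t : Tree n) → leaves (dual t) ≡ leaves t
leaves-dual (leaf _) = refl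
leaves-dual (node AND t u) = cong₂ _++_ (leaves-dual t) (leaves-dual u)
leaves-dual (node OR t u) = cong₂ _++_ (leaves-dual t) (leaves-dual u)

negate : List (List (Literal n)) → List (List (Literal n))
negate = map (map negLit)

termVal-negLit : ∀ (c : List (Literal n)) a → termVal (map negLit c) a ≡ not (clauseVal c a)
termVal-negLit [] a = refl
termVal-negLit (l ∷ c) a = trans (cong₂ _∧_ (litVal-negLit l a) (termVal-negLit c a))
  (sym (not-∨ (litVal l a) (clauseVal c a)))

clauseVal-negLit : ∀ (t : List (Literal n)) a → clauseVal (map negLit t) a ≡ not (termVal t a)
clauseVal-negLit [] a = refl
clauseVal-negLit (l ∷ t) a = trans (cong₂ _∨_ (litVal-negLit l a) (clauseVal-negLit t a))
  (sym (not-∧ (litVal l a) (termVal t a)))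

dnfVal-negate : ∀ (C : List (List (Literal n))) a → dnfVal (negate C) a ≡ not (cnfVal C a)
dnfVal-negate [] a = refl
dnfVal-negate (c ∷ C) a = trans (cong₂ _∨_ (termVal-negLit c a) (dnfVal-negate C a))
  (sym (not-∧ (clauseVal c a) (cnfVal C a)))

cnfVal-negate : ∀ (D : DNF n) a → cnfVal (negate D) a ≡ not (dnfVal D a)
cnfVal-negate [] a = refl
cnfVal-negate (t ∷ D) a = trans (cong₂ _∧_ (clauseVal-negLit t a) (cnfVal-negate D a))
  (sym (not-∨ (termVal t a) (dnfVal D a)))

DNF-not⇔CNF : ∀ {f : BoolFun n} {m} → HasDNFSize (not ∘ f) m ⇔ HasCNFSize f m
DNF-not⇔CNF {f = f} = mk⇔
  (λ (D , length≡m , D≗¬f) → negate D , trans (length-map _ D) length≡m ,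
    λ a → trans (cnfVal-negate D a) (trans (cong not (D≗¬f a)) (not-involutive (f a))))
  (λ (C , length≡m , C≗f) → negate C , trans (length-map _ C) length≡m ,
    λ a → trans (dnfVal-negate C a) (cong not (C≗f a)))

certificate-not⇔ : ∀ {f : BoolFun n} {b} → IsCertificate false (not ∘ f) b ⇔ IsCertificate true f b
certificate-not⇔ {f = f} = mk⇔
  (λ cert a a⪰b → trans (sym (not-involutive (f a))) (cong not (cert a a⪰b)))
  (λ cert a a⪰b → cong not (cert a a⪰b))

goalValue-not⇔ : ∀ {f : BoolFun n} {Q} → HasGoalValue false (not ∘ f) Q ⇔ HasGoalValue true f Q
goalValue-not⇔ = mk⇔
  (λ (g , mono , sub , certValue , nonCertValue) → g , mono , sub ,
    (λ b → certValue b ∘ Equivalence.from certificate-not⇔) ,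
    (λ b notCert → nonCertValue b (notCert ∘ Equivalence.to certificate-not⇔)))
  (λ (g , mono , sub , certValue , nonCertValue) → g , mono , sub ,
    (λ b → certValue b ∘ Equivalence.to certificate-not⇔) ,
    (λ b notCert → nonCertValue b (notCert ∘ Equivalence.from certificate-not⇔)))

IsMin-⇔ : ∀ {P P' : ℕ → Set} {m} → (∀ {k} → P k ⇔ P' k) → IsMin P m → IsMin P' m
IsMin-⇔ P⇔P' (Pm , minimal) = Equivalence.to P⇔P' Pm , λ k → minimal k ∘ Equivalence.from P⇔P'

dnfSize-dual-minimal : ∀ (t : Tree n) {f} → Unique (leaves t) → ⟦ t ⟧ ≗ f →
  IsMin (HasGoalValue true f) (dnfSize (dual t)) × IsMin (HasCNFSize f) (dnfSize (dual t))
dnfSize-dual-minimal t ro t≗f =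
  let minGoal , minDNF = dnfSize-minimal (dual t) (subst Unique (sym (leaves-dual t)) ro)
                           λ a → trans (⟦dual⟧ t a) (cong not (t≗f a))
  in IsMin-⇔ goalValue-not⇔ minGoal , IsMin-⇔ DNF-not⇔CNF minDNF

corollary1 : (n : ℕ) (f : BoolFun n) → ReadOnce f →
    Σ ℕ (λ m → IsMin (HasGoalValue false f) m × IsMin (HasDNFSize f) m) ×
    Σ ℕ (λ m → IsMin (HasGoalValue true f) m × IsMin (HasCNFSize f) m)
corollary1 n f readOnce =
  let t , ro , t≗f = ReadOnce⇒tree readOnce
  in (dnfSize t , dnfSize-minimal t ro t≗f) , (dnfSize (dual t) , dnfSize-dual-minimal t ro t≗f)
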